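{- Let $G$ be a graph having two adjacent edges $vu_1$ and $vu_2$ (with $u_1\neq u_2$) such that $G':=G-\{vu_1,vu_2\}$ admits a neighbour-sum-distinguishing edge-weighting $w_{G'}$. Assume $d_G(u_1)\geq d_G(u_2)$, and set $$\mu:=\left(d_G(u_1)+1\right)+\max\left\{0,\ d_G(v)+d_G(u_2)-d_G(u_1)-1\right\}.$$ Then, for any set $W$ of at least $\mu$ distinct strictly positive integers, $w_{G'}$ can be extended to a neighbour-sum-distinguishing edge-weighting of $G$ by assigning two distinct weights of $W$ to $vu_1$ and $vu_2$.
   Context: All graphs are finite, simple, undirected and loopless. An edge-weighting of a graph $H$ is a map $w:E(H)\to\mathbb{Z}_{>0}$. For a vertex $x$, $\sigma_w(x)=\sum_{y\in N_H(x)} w(xy)$. The weighting is neighbour-sum-distinguishing if $\sigma_w(x)\neq\sigma_w(y)$ for every edge $xy$ of $H$. $d_G(x)$ denotes the degree of $x$ in $G$. -}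

module Defs where

open import Data.Nat using (ℕ; zero; suc; _+_; _∸_; _<_; _≤_)
open import Data.Bool using (Bool; true; false; if_then_else_; _∧_; not; _∨_; T)
open import Data.Fin using (Fin; _≟_)
open import Data.List using (List; map; allFin)
open import Data.Nat.ListAction using (sum)
open import Data.Product using (_×_)
open import Relation.Nullary using (¬_)
open import Relation.Nullary.Decidable using (⌊_⌋)
open import Relation.Binary.PropositionalEquality using (_≡_)

Adj : ℕ → Set
Adj n = Fin n → Fin n → Bool

IsSimpleGraph : ∀ {n} → Adj n → Set
IsSimpleGraph {n} G = (∀ (x y : Fin n) → G x y ≡ G y x) × (∀ (x : Fin n) → G x x ≡ false)

deg : ∀ {n} → Adj n → Fin n → ℕ
deg {n} G x = sum (map (λ y → if G x y then 1 else 0) (allFin n))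

-- candidate weights on ordered pairs; only values on edges matter
Weights : ℕ → Set
Weights n = Fin n → Fin n → ℕ

IsEdgeWeighting : ∀ {n} → Adj n → Weights n → Set
IsEdgeWeighting {n} G w =
  (∀ (x y : Fin n) → T (G x y) → w x y ≡ w y x) × (∀ (x y : Fin n) → T (G x y) → 0 < w x y)

σ : ∀ {n} → Adj n → Weights n → Fin n → ℕ
σ {n} G w x = sum (map (λ y → if G x y then w x y else 0) (allFin n))

IsNSD : ∀ {n} → Adj n → Weights n → Set
IsNSD {n} G w = IsEdgeWeighting G w × (∀ (x y : Fin n) → T (G x y) → ¬ (σ G w x ≡ σ G w y))

samePair : ∀ {n} → Fin n → Fin n → Fin n → Fin n → Bool
samePair x y a b = (⌊ x ≟ a ⌋ ∧ ⌊ y ≟ b ⌋) ∨ (⌊ x ≟ b ⌋ ∧ ⌊ y ≟ a ⌋)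

removeTwo : ∀ {n} → Adj n → Fin n → Fin n → Fin n → Adj n
removeTwo G v u₁ u₂ x y = G x y ∧ not (samePair x y v u₁) ∧ not (samePair x y v u₂)

μ : ∀ {n} → Adj n → Fin n → Fin n → Fin n → ℕ
μ G v u₁ u₂ = suc (deg G u₁) + ((deg G v + deg G u₂) ∸ suc (deg G u₁))

-- Give vu₁ the weight a and vu₂ the weight b, and let s be the vertex sums of w'.
-- Only the sums at v, u₁, u₂ change, to s v + a + b, s u₁ + a and s u₂ + b, so each
-- edge at one of these vertices forbids a single value of a or of b.  Choose a first,
-- avoiding the values forced by the edges u₁y (y ≠ v) and by vu₂, which is charged to
-- the slot of the neighbour v of u₁: at most d(u₁) values.  Then choose b avoiding the
-- values forced by the other edges at u₂ and at v (vu₁ included) and the value a itself,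
-- charged to the slot of v among the neighbours of u₂: at most d(u₂) + d(v) - 1 values.
-- As μ ≥ max (d(u₁) + 1, d(u₂) + d(v)), the list W leaves room for both choices.
module Submission where

open import Defs
open import Data.Bool using (Bool; true; false; T; if_then_else_; _∧_; _∨_; not)
open import Data.Bool.Properties using (T-≡; T-not-≡; T-∧; T-∨; ¬-not; ∧-assoc; ∧-comm; ∨-comm; if-eta)
open import Data.Fin using (Fin; zero; suc; _≟_)
open import Data.Fin.Properties using (suc-injective)
open import Data.List using (List; []; _∷_; length; map; allFin; tabulate; filterᵇ; removeAt; _++_)
open import Data.List.Properties using (map-cong; map-tabulate; length-map; length-removeAt′; length-++)
open import Data.List.Membership.Propositional using (_∈_; _∉_)
open import Data.List.Membership.Propositional.Properties
  using (∈-map⁺; ∈-filter⁺; ∈-allFin; ∈-++⁺ˡ; ∈-++⁺ʳ)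
open import Data.List.Relation.Unary.All using (All)
import Data.List.Relation.Unary.All as All
open import Data.List.Relation.Unary.Any using (here; there; index)
open import Data.List.Relation.Unary.AllPairs using (_∷_)
open import Data.List.Relation.Unary.Unique.Propositional using (Unique)
open import Data.Nat using (ℕ; zero; suc; _+_; _∸_; _≤_; _<_; s≤s) renaming (_≟_ to _≟ℕ_)
open import Data.List.Membership.DecPropositional _≟ℕ_ using (_∈?_)
open import Data.Nat.ListAction using (sum)
open import Data.Nat.Properties
  using (+-identityʳ; +-comm; +-suc; +-cancelʳ-≡; m+n∸m≡n; m≤n+m∸n; m≤m+n; ≤-trans;
         +-commutativeSemigroup)
open import Algebra.Properties.CommutativeSemigroup +-commutativeSemigroup using (interchange; xy∙z≈xz∙y)
open import Data.Product using (_×_; _,_; proj₁; proj₂; Σ; ∃)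
open import Data.Sum using (_⊎_; inj₁; inj₂; [_,_])
open import Function using (_∘_)
open import Function.Bundles using (Equivalence)
open import Relation.Nullary using (¬_; yes; no; contradiction)
open import Relation.Nullary.Decidable using (Dec; ⌊_⌋; T?; toWitness; isYes≗does; dec-true; dec-false)
open import Relation.Binary.PropositionalEquality
  using (_≡_; _≢_; refl; sym; trans; cong; cong₂; subst; module ≡-Reasoning)

open Equivalence using (to; from)

private
  variable
    n : ℕ

sum-map-+ : ∀ {A : Set} (f g : A → ℕ) (xs : List A) →
            sum (map (λ y → f y + g y) xs) ≡ sum (map f xs) + sum (map g xs)
sum-map-+ f g []       = refl
sum-map-+ f g (x ∷ xs) =
  trans (cong (f x + g x +_) (sum-map-+ f g xs)) (interchange (f x) (g x) _ _)

sum-tabulate-zero : (f : Fin n → ℕ) → (∀ y → f y ≡ 0) → sum (tabulate f) ≡ 0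
sum-tabulate-zero {zero}  f f≡0 = refl
sum-tabulate-zero {suc n} f f≡0 = cong₂ _+_ (f≡0 zero) (sum-tabulate-zero (f ∘ suc) (f≡0 ∘ suc))

sum-tabulate-point : (f : Fin n → ℕ) (c : Fin n) → (∀ y → y ≢ c → f y ≡ 0) →
                     sum (tabulate f) ≡ f c
sum-tabulate-point f zero off =
  trans (cong (f zero +_) (sum-tabulate-zero (f ∘ suc) (λ y → off (suc y) λ ())))
        (+-identityʳ (f zero))
sum-tabulate-point f (suc c) off =
  trans (cong (_+ sum (tabulate (f ∘ suc))) (off zero λ ()))
        (sum-tabulate-point (f ∘ suc) c (λ y y≢c → off (suc y) (y≢c ∘ suc-injective)))

sum-allFin-zero : (f : Fin n → ℕ) → (∀ y → f y ≡ 0) → sum (map f (allFin n)) ≡ 0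
sum-allFin-zero f f≡0 = trans (cong sum (map-tabulate (λ y → y) f)) (sum-tabulate-zero f f≡0)

sum-allFin-point : (f : Fin n → ℕ) (c : Fin n) → (∀ y → y ≢ c → f y ≡ 0) →
                   sum (map f (allFin n)) ≡ f c
sum-allFin-point f c off = trans (cong sum (map-tabulate (λ y → y) f)) (sum-tabulate-point f c off)

length-filterᵇ : ∀ {A : Set} (p : A → Bool) (xs : List A) →
                 length (filterᵇ p xs) ≡ sum (map (λ y → if p y then 1 else 0) xs)
length-filterᵇ p []       = refl
length-filterᵇ p (x ∷ xs) with p x
... | true  = cong suc (length-filterᵇ p xs)
... | false = length-filterᵇ p xs

∈-─ : ∀ {A : Set} {x y : A} {xs : List A} (x∈xs : x ∈ xs) →
      y ∈ xs → y ≢ x → y ∈ removeAt xs (index x∈xs)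
∈-─ (here refl)  (here refl)  y≢x = contradiction refl y≢x
∈-─ (here refl)  (there y∈xs) _   = y∈xs
∈-─ (there x∈xs) (here refl)  _   = here refl
∈-─ (there x∈xs) (there y∈xs) y≢x = there (∈-─ x∈xs y∈xs y≢x)

∃-∉-of-longer : (W L : List ℕ) → Unique W → length L < length W → ∃ λ x → x ∈ W × x ∉ L
∃-∉-of-longer (x ∷ W) L (x∉W ∷ W!) |L|<|W| with x ∈? L
... | no x∉L  = x , here refl , x∉L
... | yes x∈L =
  let y , y∈W , y∉L─x = ∃-∉-of-longer W (removeAt L (index x∈L)) W! |L─x|<|W|
  in  y , there y∈W , λ y∈L → y∉L─x (∈-─ x∈L y∈L (λ y≡x → All.lookup x∉W y∈W (sym y≡x)))
  where
  |L─x|<|W| : suc (length (removeAt L (index x∈L))) ≤ length W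
  |L─x|<|W| with s≤s le ← subst (_< length (x ∷ W)) (length-removeAt′ L (index x∈L)) |L|<|W| = le

m+n≡o⇒n≡o∸m : ∀ m {n o} → m + n ≡ o → n ≡ o ∸ m
m+n≡o⇒n≡o∸m m {n} eq = trans (sym (m+n∸m≡n m n)) (cong (_∸ m) eq)

∉⇒≢ : ∀ {A : Set} {x y : A} {xs : List A} → x ∉ xs → y ∈ xs → x ≢ y
∉⇒≢ x∉xs y∈xs refl = x∉xs y∈xs

isYes-true : ∀ {A : Set} (a? : Dec A) → A → ⌊ a? ⌋ ≡ true
isYes-true a? a = trans (isYes≗does a?) (dec-true a? a)

isYes-false : ∀ {A : Set} (a? : Dec A) → ¬ A → ⌊ a? ⌋ ≡ false
isYes-false a? ¬a = trans (isYes≗does a?) (dec-false a? ¬a)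

if-yes : ∀ {A B : Set} (a? : Dec A) {x y : B} → A → (if ⌊ a? ⌋ then x else y) ≡ x
if-yes a? a = cong (λ b → if b then _ else _) (isYes-true a? a)

if-no : ∀ {A B : Set} (a? : Dec A) {x y : B} → ¬ A → (if ⌊ a? ⌋ then x else y) ≡ y
if-no a? ¬a = cong (λ b → if b then _ else _) (isYes-false a? ¬a)

¬T⇒≡false : ∀ {b} → ¬ T b → b ≡ false
¬T⇒≡false ¬b = ¬-not (¬b ∘ from T-≡)

Symmetric : Adj n → Set
Symmetric {n} H = ∀ (x y : Fin n) → H x y ≡ H y x

edgeGraph : Fin n → Fin n → Adj n
edgeGraph p q x y = samePair x y p q

removeEdge : Adj n → Fin n → Fin n → Adj n
removeEdge H p q x y = H x y ∧ not (samePair x y p q)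

setEdge : Weights n → Fin n → Fin n → ℕ → Weights n
setEdge w p q c x y = if samePair x y p q then c else w x y

module _ (x y p q : Fin n) where

  samePair-sound : T (samePair x y p q) → (x ≡ p × y ≡ q) ⊎ (x ≡ q × y ≡ p)
  samePair-sound t with to T-∨ t
  ... | inj₁ t₁ = let t₁₁ , t₁₂ = to T-∧ t₁ in
                  inj₁ (toWitness {a? = x ≟ p} t₁₁ , toWitness {a? = y ≟ q} t₁₂)
  ... | inj₂ t₂ = let t₂₁ , t₂₂ = to T-∧ t₂ in
                  inj₂ (toWitness {a? = x ≟ q} t₂₁ , toWitness {a? = y ≟ p} t₂₂)

  samePair-false : ¬ (x ≡ p × y ≡ q) → ¬ (x ≡ q × y ≡ p) → samePair x y p q ≡ false
  samePair-false ¬pq ¬qp = ¬T⇒≡false ([ ¬pq , ¬qp ] ∘ samePair-sound)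

  samePair-comm : samePair x y p q ≡ samePair y x p q
  samePair-comm = trans (∨-comm (⌊ x ≟ p ⌋ ∧ ⌊ y ≟ q ⌋) _)
                        (cong₂ _∨_ (∧-comm ⌊ x ≟ q ⌋ _) (∧-comm ⌊ x ≟ p ⌋ _))

  samePair-swap : samePair x y p q ≡ samePair x y q p
  samePair-swap = ∨-comm (⌊ x ≟ p ⌋ ∧ ⌊ y ≟ q ⌋) _

samePair-refl : (p q : Fin n) → samePair p q p q ≡ true
samePair-refl p q =
  cong₂ (λ b c → (b ∧ c) ∨ (⌊ p ≟ q ⌋ ∧ ⌊ q ≟ p ⌋)) (isYes-true (p ≟ p) refl) (isYes-true (q ≟ q) refl)

edgeGraph⊆ : {H : Adj n} → Symmetric H → ∀ {p q} → T (H p q) →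
             ∀ x y → T (edgeGraph p q x y) → T (H x y)
edgeGraph⊆ H-sym {p} {q} pq x y t with samePair-sound x y p q t
... | inj₁ (refl , refl) = pq
... | inj₂ (refl , refl) = subst T (H-sym _ _) pq

removeEdge-intro : ∀ {H : Adj n} {p q x y} → T (H x y) → samePair x y p q ≡ false →
                   T (removeEdge H p q x y)
removeEdge-intro xy s = from T-∧ (xy , from T-not-≡ s)

removeEdge-sym : {H : Adj n} → Symmetric H → ∀ p q → Symmetric (removeEdge H p q)
removeEdge-sym H-sym p q x y = cong₂ (λ b c → b ∧ not c) (H-sym x y) (samePair-comm x y p q)

σ-cong : ∀ {H K : Adj n} {w w' : Weights n} x →
         (∀ y → H x y ≡ K x y) → (∀ y → w x y ≡ w' x y) → σ H w x ≡ σ K w' x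
σ-cong {n} x H≗K w≗w' =
  cong sum (map-cong (λ y → cong₂ (λ b k → if b then k else 0) (H≗K y) (w≗w' y)) (allFin n))

private
  if-setEdge-split : ∀ h s {k c : ℕ} → (T s → T h) →
    (if h then (if s then c else k) else 0) ≡ (if h ∧ not s then k else 0) + (if s then c else 0)
  if-setEdge-split true  true  _    = refl
  if-setEdge-split true  false _    = sym (+-identityʳ _)
  if-setEdge-split false true  s⇒h = contradiction (s⇒h _) λ ()
  if-setEdge-split false false _    = refl

σ-setEdge : ∀ {H : Adj n} {p q} → (∀ x y → T (edgeGraph p q x y) → T (H x y)) →
            ∀ w c x → σ H (setEdge w p q c) x
                      ≡ σ (removeEdge H p q) w x + σ (edgeGraph p q) (λ _ _ → c) x
σ-setEdge {n} {H} {p} {q} pq⊆H w c x =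
  trans (cong sum (map-cong (λ y → if-setEdge-split (H x y) (samePair x y p q) (pq⊆H x y)) (allFin n)))
        (sum-map-+ _ _ (allFin n))

σ-edgeGraph-source : ∀ {p q : Fin n} c → p ≢ q → σ (edgeGraph p q) (λ _ _ → c) p ≡ c
σ-edgeGraph-source {n} {p} {q} c p≢q =
  trans (sum-allFin-point _ q off) (cong (λ b → if b then c else 0) (samePair-refl p q))
  where
  off : ∀ y → y ≢ q → (if samePair p y p q then c else 0) ≡ 0
  off y y≢q = cong (λ b → if b then c else 0) (samePair-false p y p q (y≢q ∘ proj₂) (p≢q ∘ proj₁))

σ-edgeGraph-target : ∀ {p q : Fin n} c → p ≢ q → σ (edgeGraph p q) (λ _ _ → c) q ≡ c
σ-edgeGraph-target {p = p} {q} c p≢q =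
  trans (σ-cong {H = edgeGraph p q} {edgeGraph q p} q (λ y → samePair-swap q y p q) (λ _ → refl))
        (σ-edgeGraph-source c (p≢q ∘ sym))

σ-edgeGraph-other : ∀ {p q x : Fin n} c → x ≢ p → x ≢ q → σ (edgeGraph p q) (λ _ _ → c) x ≡ 0
σ-edgeGraph-other {p = p} {q} {x} c x≢p x≢q =
  sum-allFin-zero _ λ y →
    cong (λ b → if b then c else 0) (samePair-false x y p q (x≢p ∘ proj₁) (x≢q ∘ proj₁))

deg-removeEdge : ∀ {H : Adj n} {p q} → Symmetric H → T (H p q) → p ≢ q →
                 deg H p ≡ suc (deg (removeEdge H p q) p)
deg-removeEdge {H = H} {p} {q} H-sym pq p≢q = begin
  deg H p
    ≡⟨ σ-cong {H = H} {H} {one} {setEdge one p q 1} p (λ _ → refl) (λ y → sym (if-eta (samePair p y p q))) ⟩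
  σ H (setEdge one p q 1) p
    ≡⟨ σ-setEdge (edgeGraph⊆ H-sym pq) one 1 p ⟩
  deg (removeEdge H p q) p + σ (edgeGraph p q) one p
    ≡⟨ cong (deg (removeEdge H p q) p +_) (σ-edgeGraph-source 1 p≢q) ⟩
  deg (removeEdge H p q) p + 1
    ≡⟨ +-comm _ 1 ⟩
  suc (deg (removeEdge H p q) p)
    ∎
  where
  open ≡-Reasoning
  one : Weights _
  one _ _ = 1

setEdge-on : ∀ (w : Weights n) p q c x y → samePair x y p q ≡ true → setEdge w p q c x y ≡ c
setEdge-on w p q c x y s = cong (λ b → if b then c else w x y) s

setEdge-off : ∀ (w : Weights n) p q c x y → samePair x y p q ≡ false → setEdge w p q c x y ≡ w x y
setEdge-off w p q c x y s = cong (λ b → if b then c else w x y) s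

setEdge-isEdgeWeighting : ∀ {H : Adj n} {w p q c} → IsEdgeWeighting (removeEdge H p q) w → 0 < c →
                          IsEdgeWeighting H (setEdge w p q c)
setEdge-isEdgeWeighting {H = H} {w} {p} {q} {c} (w-sym , w-pos) c-pos = symmetric , positive
  where
  symmetric : ∀ x y → T (H x y) → setEdge w p q c x y ≡ setEdge w p q c y x
  symmetric x y xy rewrite sym (samePair-comm x y p q) with samePair x y p q in s
  ... | true  = refl
  ... | false = w-sym x y (removeEdge-intro {H = H} {p} {q} xy s)

  positive : ∀ x y → T (H x y) → 0 < setEdge w p q c x y
  positive x y xy with samePair x y p q in s
  ... | true  = c-pos
  ... | false = w-pos x y (removeEdge-intro {H = H} {p} {q} xy s)

isEdgeWeighting-cong : ∀ {H K : Adj n} {w} → (∀ x y → H x y ≡ K x y) →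
                       IsEdgeWeighting K w → IsEdgeWeighting H w
isEdgeWeighting-cong H≡K (w-sym , w-pos) =
  (λ x y → w-sym x y ∘ subst T (H≡K x y)) , (λ x y → w-pos x y ∘ subst T (H≡K x y))

neighbourValues : Adj n → Fin n → (Fin n → ℕ) → List ℕ
neighbourValues {n} H x f = map f (filterᵇ (H x) (allFin n))

∈-neighbourValues : ∀ (H : Adj n) x {y} (f : Fin n → ℕ) → T (H x y) → f y ∈ neighbourValues H x f
∈-neighbourValues H x {y} f xy = ∈-map⁺ f (∈-filter⁺ (T? ∘ H x) (∈-allFin y) xy)

length-neighbourValues : ∀ (H : Adj n) x (f : Fin n → ℕ) → length (neighbourValues H x f) ≡ deg H x
length-neighbourValues {n} H x f =
  trans (length-map f (filterᵇ (H x) (allFin n))) (length-filterᵇ (H x) (allFin n))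

module Extension {G : Adj n} (G-simple : IsSimpleGraph G)
  {v u₁ u₂ : Fin n} (vu₁ : T (G v u₁)) (vu₂ : T (G v u₂)) (u₁≢u₂ : u₁ ≢ u₂)
  {w' : Weights n} (w'-nsd : IsNSD (removeTwo G v u₁ u₂) w') where

  G-sym : Symmetric G
  G-sym = proj₁ G-simple

  T-sym : ∀ {x y} → T (G x y) → T (G y x)
  T-sym {x} {y} = subst T (G-sym x y)

  ¬loop : ∀ {x} → ¬ T (G x x)
  ¬loop {x} = subst T (proj₂ G-simple x)

  v≢u₁ : v ≢ u₁
  v≢u₁ refl = ¬loop vu₁

  v≢u₂ : v ≢ u₂
  v≢u₂ refl = ¬loop vu₂

  vu₁≠vu₂ : samePair v u₁ v u₂ ≡ false
  vu₁≠vu₂ = samePair-false v u₁ v u₂ (u₁≢u₂ ∘ proj₂) (v≢u₂ ∘ proj₁)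

  vu₂≠vu₁ : samePair v u₂ v u₁ ≡ false
  vu₂≠vu₁ = samePair-false v u₂ v u₁ (u₁≢u₂ ∘ sym ∘ proj₂) (v≢u₁ ∘ proj₁)

  data Role : Fin n → Set where
    at-v      : Role v
    at-u₁     : Role u₁
    at-u₂     : Role u₂
    elsewhere : ∀ {x} → x ≢ v → x ≢ u₁ → x ≢ u₂ → Role x

  role : ∀ x → Role x
  role x with x ≟ v | x ≟ u₁ | x ≟ u₂
  ... | yes refl | _        | _        = at-v
  ... | no _     | yes refl | _        = at-u₁
  ... | no _     | no _     | yes refl = at-u₂
  ... | no x≢v   | no x≢u₁  | no x≢u₂  = elsewhere x≢v x≢u₁ x≢u₂

  s : Fin n → ℕ
  s = σ (removeTwo G v u₁ u₂) w'

  forbiddenA : List ℕ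
  forbiddenA = neighbourValues G u₁ λ y → if ⌊ y ≟ v ⌋ then s u₂ ∸ s v else s y ∸ s u₁

  length-forbiddenA : length forbiddenA ≡ deg G u₁
  length-forbiddenA = length-neighbourValues G u₁ _

  ∈-forbiddenA-v : s u₂ ∸ s v ∈ forbiddenA
  ∈-forbiddenA-v = subst (_∈ forbiddenA) (if-yes (v ≟ v) refl) (∈-neighbourValues G u₁ _ (T-sym vu₁))

  ∈-forbiddenA : ∀ {y} → T (G u₁ y) → y ≢ v → s y ∸ s u₁ ∈ forbiddenA
  ∈-forbiddenA {y} u₁y y≢v = subst (_∈ forbiddenA) (if-no (y ≟ v) y≢v) (∈-neighbourValues G u₁ _ u₁y)

  module _ (a : ℕ) where

    forbiddenB₂ : List ℕ
    forbiddenB₂ = neighbourValues G u₂ λ y →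
      if ⌊ y ≟ v ⌋ then a else if ⌊ y ≟ u₁ ⌋ then (s u₁ + a) ∸ s u₂ else s y ∸ s u₂

    forbiddenBᵥ : List ℕ
    forbiddenBᵥ = neighbourValues (removeEdge G v u₂) v λ y →
      if ⌊ y ≟ u₁ ⌋ then s u₁ ∸ s v else s y ∸ (s v + a)

    forbiddenB : List ℕ
    forbiddenB = forbiddenB₂ ++ forbiddenBᵥ

    suc-length-forbiddenB : suc (length forbiddenB) ≡ deg G v + deg G u₂
    suc-length-forbiddenB = begin
      suc (length forbiddenB)
        ≡⟨ cong suc (length-++ forbiddenB₂) ⟩
      suc (length forbiddenB₂ + length forbiddenBᵥ)
        ≡⟨ cong₂ (λ d e → suc (d + e)) (length-neighbourValues G u₂ _)
                                        (length-neighbourValues (removeEdge G v u₂) v _) ⟩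
      suc (deg G u₂ + deg (removeEdge G v u₂) v)
        ≡⟨ sym (+-suc (deg G u₂) _) ⟩
      deg G u₂ + suc (deg (removeEdge G v u₂) v)
        ≡⟨ cong (deg G u₂ +_) (sym (deg-removeEdge G-sym vu₂ v≢u₂)) ⟩
      deg G u₂ + deg G v
        ≡⟨ +-comm (deg G u₂) (deg G v) ⟩
      deg G v + deg G u₂
        ∎
      where open ≡-Reasoning

    a∈forbiddenB : a ∈ forbiddenB
    a∈forbiddenB =
      ∈-++⁺ˡ (subst (_∈ forbiddenB₂) (if-yes (v ≟ v) refl) (∈-neighbourValues G u₂ _ (T-sym vu₂)))

    ∈-forbiddenB-u₁ : T (G u₂ u₁) → (s u₁ + a) ∸ s u₂ ∈ forbiddenB
    ∈-forbiddenB-u₁ u₂u₁ = ∈-++⁺ˡ (subst (_∈ forbiddenB₂)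
      (trans (if-no (u₁ ≟ v) (v≢u₁ ∘ sym)) (if-yes (u₁ ≟ u₁) refl)) (∈-neighbourValues G u₂ _ u₂u₁))

    ∈-forbiddenB-u₂ : ∀ {y} → T (G u₂ y) → y ≢ v → y ≢ u₁ → s y ∸ s u₂ ∈ forbiddenB
    ∈-forbiddenB-u₂ {y} u₂y y≢v y≢u₁ = ∈-++⁺ˡ (subst (_∈ forbiddenB₂)
      (trans (if-no (y ≟ v) y≢v) (if-no (y ≟ u₁) y≢u₁)) (∈-neighbourValues G u₂ _ u₂y))

    ∈-forbiddenB-vu₁ : s u₁ ∸ s v ∈ forbiddenB
    ∈-forbiddenB-vu₁ = ∈-++⁺ʳ forbiddenB₂ (subst (_∈ forbiddenBᵥ) (if-yes (u₁ ≟ u₁) refl)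
      (∈-neighbourValues (removeEdge G v u₂) v _
        (removeEdge-intro {H = G} {v} {u₂} vu₁ vu₁≠vu₂)))

    ∈-forbiddenB-v : ∀ {y} → T (G v y) → y ≢ u₂ → y ≢ u₁ → s y ∸ (s v + a) ∈ forbiddenB
    ∈-forbiddenB-v {y} vy y≢u₂ y≢u₁ = ∈-++⁺ʳ forbiddenB₂ (subst (_∈ forbiddenBᵥ) (if-no (y ≟ u₁) y≢u₁)
      (∈-neighbourValues (removeEdge G v u₂) v _
        (removeEdge-intro {H = G} {v} {u₂} vy (samePair-false v y v u₂ (y≢u₂ ∘ proj₂) (v≢u₂ ∘ proj₁)))))

  module _ (a b : ℕ) where

    w : Weights n
    w = setEdge (setEdge w' v u₂ b) v u₁ a

    w-vu₁ : w v u₁ ≡ a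
    w-vu₁ = setEdge-on (setEdge w' v u₂ b) v u₁ a v u₁ (samePair-refl v u₁)

    w-vu₂ : w v u₂ ≡ b
    w-vu₂ = trans (setEdge-off (setEdge w' v u₂ b) v u₁ a v u₂ vu₂≠vu₁)
                  (setEdge-on w' v u₂ b v u₂ (samePair-refl v u₂))

    w-extends : ∀ x y → T (removeTwo G v u₁ u₂ x y) → w x y ≡ w' x y
    w-extends x y t =
      let _ , ¬vu₁¬vu₂ = to (T-∧ {G x y}) t
          ¬vu₁ , ¬vu₂ = to (T-∧ {not (samePair x y v u₁)}) ¬vu₁¬vu₂
      in  trans (setEdge-off (setEdge w' v u₂ b) v u₁ a x y (to T-not-≡ ¬vu₁))
            (setEdge-off w' v u₂ b x y (to T-not-≡ ¬vu₂))

    private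
      G₁ : Adj n
      G₁ = removeEdge G v u₁

      G₁-vu₂ : T (G₁ v u₂)
      G₁-vu₂ = removeEdge-intro {H = G} {v} {u₁} vu₂ vu₂≠vu₁

      G₁-removeEdge : ∀ x y → removeEdge G₁ v u₂ x y ≡ removeTwo G v u₁ u₂ x y
      G₁-removeEdge x y = ∧-assoc (G x y) _ _

    w-isEdgeWeighting : 0 < a → 0 < b → IsEdgeWeighting G w
    w-isEdgeWeighting a-pos b-pos =
      setEdge-isEdgeWeighting
        (setEdge-isEdgeWeighting {H = G₁} (isEdgeWeighting-cong G₁-removeEdge (proj₁ w'-nsd)) b-pos)
        a-pos

    σ-w : ∀ x → σ G w x ≡ s x + σ (edgeGraph v u₂) (λ _ _ → b) x + σ (edgeGraph v u₁) (λ _ _ → a) x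
    σ-w x = begin
      σ G w x
        ≡⟨ σ-setEdge (edgeGraph⊆ G-sym vu₁) (setEdge w' v u₂ b) a x ⟩
      σ G₁ (setEdge w' v u₂ b) x + A x
        ≡⟨ cong (_+ A x) (σ-setEdge (edgeGraph⊆ (removeEdge-sym G-sym v u₁) G₁-vu₂) w' b x) ⟩
      σ (removeEdge G₁ v u₂) w' x + B x + A x
        ≡⟨ cong (λ t → t + B x + A x) (σ-cong {H = removeEdge G₁ v u₂} {removeTwo G v u₁ u₂} {w'} {w'} x
                                                (G₁-removeEdge x) (λ _ → refl)) ⟩
      s x + B x + A x
        ∎
      where
      open ≡-Reasoning
      A B : Fin n → ℕ
      A = σ (edgeGraph v u₁) (λ _ _ → a)
      B = σ (edgeGraph v u₂) (λ _ _ → b)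

    σ-w-v : σ G w v ≡ s v + b + a
    σ-w-v = trans (σ-w v) (cong₂ (λ β α → s v + β + α)
      (σ-edgeGraph-source {p = v} {u₂} b v≢u₂) (σ-edgeGraph-source {p = v} {u₁} a v≢u₁))

    σ-w-u₁ : σ G w u₁ ≡ s u₁ + a
    σ-w-u₁ = trans (σ-w u₁) (trans (cong₂ (λ β α → s u₁ + β + α)
      (σ-edgeGraph-other {p = v} {u₂} b (v≢u₁ ∘ sym) u₁≢u₂) (σ-edgeGraph-target {p = v} {u₁} a v≢u₁))
      (cong (_+ a) (+-identityʳ (s u₁))))

    σ-w-u₂ : σ G w u₂ ≡ s u₂ + b
    σ-w-u₂ = trans (σ-w u₂) (trans (cong₂ (λ β α → s u₂ + β + α)
      (σ-edgeGraph-target {p = v} {u₂} b v≢u₂) (σ-edgeGraph-other {p = v} {u₁} a (v≢u₂ ∘ sym) (u₁≢u₂ ∘ sym)))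
      (+-identityʳ (s u₂ + b)))

    σ-w-elsewhere : ∀ {x} → x ≢ v → x ≢ u₁ → x ≢ u₂ → σ G w x ≡ s x
    σ-w-elsewhere {x} x≢v x≢u₁ x≢u₂ = trans (σ-w x) (trans (cong₂ (λ β α → s x + β + α)
      (σ-edgeGraph-other {p = v} {u₂} b x≢v x≢u₂) (σ-edgeGraph-other {p = v} {u₁} a x≢v x≢u₁))
      (trans (+-identityʳ (s x + 0)) (+-identityʳ (s x))))

    module _ (a∉forbiddenA : a ∉ forbiddenA) (b∉forbiddenB : b ∉ forbiddenB a) where

      private
        sums : ∀ {x y P Q} → σ G w x ≡ P → σ G w y ≡ Q → σ G w x ≡ σ G w y → P ≡ Q
        sums σx σy eq = trans (sym σx) (trans eq σy)

      v≁u₁ : σ G w v ≢ σ G w u₁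
      v≁u₁ eq = ∉⇒≢ b∉forbiddenB (∈-forbiddenB-vu₁ a)
        (m+n≡o⇒n≡o∸m (s v) (+-cancelʳ-≡ a (s v + b) (s u₁) (sums σ-w-v σ-w-u₁ eq)))

      v≁u₂ : σ G w v ≢ σ G w u₂
      v≁u₂ eq = ∉⇒≢ a∉forbiddenA ∈-forbiddenA-v (m+n≡o⇒n≡o∸m (s v)
        (+-cancelʳ-≡ b (s v + a) (s u₂) (trans (xy∙z≈xz∙y (s v) a b) (sums σ-w-v σ-w-u₂ eq))))

      u₁≁u₂ : T (G u₁ u₂) → σ G w u₁ ≢ σ G w u₂
      u₁≁u₂ u₁u₂ eq = ∉⇒≢ b∉forbiddenB (∈-forbiddenB-u₁ a (T-sym u₁u₂))
        (m+n≡o⇒n≡o∸m (s u₂) (sym (sums σ-w-u₁ σ-w-u₂ eq)))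

      module _ {y} (y≢v : y ≢ v) (y≢u₁ : y ≢ u₁) (y≢u₂ : y ≢ u₂) where

        v≁elsewhere : T (G v y) → σ G w v ≢ σ G w y
        v≁elsewhere vy eq = ∉⇒≢ b∉forbiddenB (∈-forbiddenB-v a vy y≢u₂ y≢u₁) (m+n≡o⇒n≡o∸m (s v + a)
          (trans (xy∙z≈xz∙y (s v) a b) (sums σ-w-v (σ-w-elsewhere y≢v y≢u₁ y≢u₂) eq)))

        u₁≁elsewhere : T (G u₁ y) → σ G w u₁ ≢ σ G w y
        u₁≁elsewhere u₁y eq = ∉⇒≢ a∉forbiddenA (∈-forbiddenA u₁y y≢v)
          (m+n≡o⇒n≡o∸m (s u₁) (sums σ-w-u₁ (σ-w-elsewhere y≢v y≢u₁ y≢u₂) eq))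

        u₂≁elsewhere : T (G u₂ y) → σ G w u₂ ≢ σ G w y
        u₂≁elsewhere u₂y eq = ∉⇒≢ b∉forbiddenB (∈-forbiddenB-u₂ a u₂y y≢v y≢u₁)
          (m+n≡o⇒n≡o∸m (s u₂) (sums σ-w-u₂ (σ-w-elsewhere y≢v y≢u₁ y≢u₂) eq))

        elsewhere≁elsewhere : ∀ {z} → z ≢ v → z ≢ u₁ → z ≢ u₂ → T (G y z) → σ G w y ≢ σ G w z
        elsewhere≁elsewhere {z} z≢v z≢u₁ z≢u₂ yz eq =
          proj₂ w'-nsd y z yz' (sums (σ-w-elsewhere y≢v y≢u₁ y≢u₂) (σ-w-elsewhere z≢v z≢u₁ z≢u₂) eq)
          where
          off : ∀ {q} → y ≢ q → not (samePair y z v q) ≡ true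
          off {q} y≢q = cong not (samePair-false y z v q (y≢v ∘ proj₁) (y≢q ∘ proj₁))
          yz' : T (removeTwo G v u₁ u₂ y z)
          yz' = from T-∧ (yz , from T-∧ (from T-≡ (off y≢u₁) , from T-≡ (off y≢u₂)))

      σ-w-distinct : ∀ x y → T (G x y) → σ G w x ≢ σ G w y
      σ-w-distinct x y xy with role x | role y
      ... | at-v  | at-v  = contradiction xy ¬loop
      ... | at-v  | at-u₁ = v≁u₁
      ... | at-v  | at-u₂ = v≁u₂
      ... | at-v  | elsewhere y≢v y≢u₁ y≢u₂ = v≁elsewhere y≢v y≢u₁ y≢u₂ xy
      ... | at-u₁ | at-v  = v≁u₁ ∘ sym
      ... | at-u₁ | at-u₁ = contradiction xy ¬loop
      ... | at-u₁ | at-u₂ = u₁≁u₂ xy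
      ... | at-u₁ | elsewhere y≢v y≢u₁ y≢u₂ = u₁≁elsewhere y≢v y≢u₁ y≢u₂ xy
      ... | at-u₂ | at-v  = v≁u₂ ∘ sym
      ... | at-u₂ | at-u₁ = u₁≁u₂ (T-sym xy) ∘ sym
      ... | at-u₂ | at-u₂ = contradiction xy ¬loop
      ... | at-u₂ | elsewhere y≢v y≢u₁ y≢u₂ = u₂≁elsewhere y≢v y≢u₁ y≢u₂ xy
      ... | elsewhere x≢v x≢u₁ x≢u₂ | at-v  = v≁elsewhere x≢v x≢u₁ x≢u₂ (T-sym xy) ∘ sym
      ... | elsewhere x≢v x≢u₁ x≢u₂ | at-u₁ = u₁≁elsewhere x≢v x≢u₁ x≢u₂ (T-sym xy) ∘ sym
      ... | elsewhere x≢v x≢u₁ x≢u₂ | at-u₂ = u₂≁elsewhere x≢v x≢u₁ x≢u₂ (T-sym xy) ∘ sym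
      ... | elsewhere x≢v x≢u₁ x≢u₂ | elsewhere y≢v y≢u₁ y≢u₂ =
        elsewhere≁elsewhere x≢v x≢u₁ x≢u₂ y≢v y≢u₁ y≢u₂ xy

      w-isNSD : 0 < a → 0 < b → IsNSD G w
      w-isNSD a-pos b-pos = w-isEdgeWeighting a-pos b-pos , σ-w-distinct

mainTheorem3 : (n : ℕ) (G : Adj n) → IsSimpleGraph G →
    (v u₁ u₂ : Fin n) → T (G v u₁) → T (G v u₂) → ¬ (u₁ ≡ u₂) →
    (w' : Weights n) → IsNSD (removeTwo G v u₁ u₂) w' →
    deg G u₂ ≤ deg G u₁ →
    (W : List ℕ) → Unique W → All (λ k → 0 < k) W → μ G v u₁ u₂ ≤ length W →
    Σ ℕ (λ a → Σ ℕ (λ b → a ∈ W × b ∈ W × ¬ (a ≡ b) ×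
      Σ (Weights n) (λ w → IsNSD G w × w v u₁ ≡ a × w v u₂ ≡ b ×
        (∀ (x y : Fin n) → T (removeTwo G v u₁ u₂ x y) → w x y ≡ w' x y))))
mainTheorem3 n G G-simple v u₁ u₂ vu₁ vu₂ u₁≢u₂ w' w'-nsd _ W W-unique W-pos μ≤|W| =
  let a , a∈W , a∉forbiddenA = ∃-∉-of-longer W forbiddenA W-unique |forbiddenA|<|W|
      b , b∈W , b∉forbiddenB = ∃-∉-of-longer W (forbiddenB a) W-unique (|forbiddenB|<|W| a)
  in  a , b , a∈W , b∈W , (λ a≡b → b∉forbiddenB (subst (_∈ forbiddenB a) a≡b (a∈forbiddenB a))) ,
      w a b , w-isNSD a b a∉forbiddenA b∉forbiddenB (All.lookup W-pos a∈W) (All.lookup W-pos b∈W) ,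
      w-vu₁ a b , w-vu₂ a b , w-extends a b
  where
  open Extension G-simple vu₁ vu₂ u₁≢u₂ w'-nsd

  |forbiddenA|<|W| : length forbiddenA < length W
  |forbiddenA|<|W| = subst (λ d → suc d ≤ length W) (sym length-forbiddenA)
                           (≤-trans (m≤m+n (suc (deg G u₁)) _) μ≤|W|)

  |forbiddenB|<|W| : ∀ a → length (forbiddenB a) < length W
  |forbiddenB|<|W| a = subst (_≤ length W) (sym (suc-length-forbiddenB a))
                             (≤-trans (m≤n+m∸n (deg G v + deg G u₂) (suc (deg G u₁))) μ≤|W|)
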